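{- Let $W$ be a monoid and let $(T,\mathrm{map}_T,\mathrm{ret},\mathrm{join},\mathrm{dec},\mathrm{dist})$ be a decorated traversable monad (DTM) over $W$. Define, for each applicative functor $F$, sets $A,B$ and $f:W\times A\to F(TB)$, $$\mathrm{binddt}_F\,f := \mathrm{map}_F(\mathrm{join})\circ \mathrm{dist}_F\circ \mathrm{map}_T f\circ \mathrm{dec} : TA\to F(TB).$$ Then $(\mathrm{ret},\mathrm{binddt})$ satisfies: (K1) $\mathrm{binddt}_{\mathbb 1}(\mathrm{ret}\circ\mathrm{extr})=\mathrm{id}_{TA}$; (K2) $\mathrm{binddt}_F f\circ\mathrm{ret}=f\circ\mathrm{ret}_{W\times}$; (K3) $\mathrm{map}_F(\mathrm{binddt}_G g)\circ\mathrm{binddt}_F f=\mathrm{binddt}_{F\circ G}\big(\lambda(w,a).\,\mathrm{map}_F(\mathrm{binddt}_G(g\odot w))(f(w,a))\big)$ for applicatives $F,G$, where $(g\odot w_1)(w_2,b):=g(w_1\cdot w_2,b)$; (K4) $\phi\circ\mathrm{binddt}_F f=\mathrm{binddt}_G(\phi\circ f)$ for every applicative morphism $\phi:F\Rightarrow G$.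
   Context: All functors are endofunctors of $\mathbf{Set}$; $\mathrm{map}_F$ is the action of $F$ on functions; $\mathbb 1$ is the identity functor. Applicative functor: $F$ with $\mathrm{pure}:A\to FA$ and $\circledast:F(A\to B)\to FA\to FB$ (left associative) satisfying $\mathrm{pure}\,\mathrm{id}\circledast a=a$; $\mathrm{pure}\,f\circledast\mathrm{pure}\,a=\mathrm{pure}(fa)$; $g\circledast(f\circledast a)=\mathrm{pure}(\circ)\circledast g\circledast f\circledast a$; $f\circledast\mathrm{pure}\,a=\mathrm{pure}(\lambda h.\,h\,a)\circledast f$; $\mathrm{map}_F f\,x=\mathrm{pure}f\circledast x$. Identity and composites of applicatives are applicative. An applicative morphism $\phi:F\Rightarrow G$ is a natural transformation preserving $\mathrm{pure}$ and $\circledast$. On $W\times-$: $\mathrm{extr}(w,a)=a$, $\mathrm{dup}(w,a)=(w,(w,a))$, $\mathrm{ret}_{W\times}(a)=(1_W,a)$, $\mathrm{join}_{W\times}(w_1,(w_2,a))=(w_1\cdot w_2,a)$. For a functor $G$, $\sigma_G:W\times GA\to G(W\times A)$, $\sigma_G(w,x)=\mathrm{map}_G(\lambda a.(w,a))x$. A DTM is a functor $T$ with natural transformations $\mathrm{ret}:A\to TA$, $\mathrm{join}:T(TA)\to TA$, $\mathrm{dec}:TA\to T(W\times A)$ and, for each applicative $F$, $\mathrm{dist}_F:T(FA)\to F(TA)$ natural in $A$, satisfying: $\mathrm{join}\circ\mathrm{ret}=\mathrm{id}$, $\mathrm{join}\circ\mathrm{map}_T\mathrm{ret}=\mathrm{id}$,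 $\mathrm{join}\circ\mathrm{join}=\mathrm{join}\circ\mathrm{map}_T\mathrm{join}$; $\mathrm{map}_T\mathrm{extr}\circ\mathrm{dec}=\mathrm{id}$, $\mathrm{map}_T\mathrm{dup}\circ\mathrm{dec}=\mathrm{dec}\circ\mathrm{dec}$; $\mathrm{dec}\circ\mathrm{ret}=\mathrm{ret}\circ\mathrm{ret}_{W\times}$, $\mathrm{dec}\circ\mathrm{join}=\mathrm{join}\circ\mathrm{map}_T(\mathrm{map}_T(\mathrm{join}_{W\times})\circ\sigma_T)\circ\mathrm{dec}\circ\mathrm{map}_T\mathrm{dec}$; $\mathrm{dist}_{\mathbb 1}=\mathrm{id}$, $\mathrm{dist}_{F\circ G}=\mathrm{map}_F(\mathrm{dist}_G)\circ\mathrm{dist}_F$, $\phi\circ\mathrm{dist}_F=\mathrm{dist}_G\circ\mathrm{map}_T\phi$ for applicative morphisms $\phi:F\Rightarrow G$; $\mathrm{dist}_F\circ\mathrm{ret}=\mathrm{map}_F\mathrm{ret}$, $\mathrm{dist}_F\circ\mathrm{join}=\mathrm{map}_F\mathrm{join}\circ\mathrm{dist}_F\circ\mathrm{map}_T\mathrm{dist}_F$; $\mathrm{map}_F\mathrm{dec}\circ\mathrm{dist}_F=\mathrm{dist}_F\circ\mathrm{map}_T(\sigma_F)\circ\mathrm{dec}$. -}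

module Defs where

open import Level using (0ℓ)
open import Function using (id; _∘_; _∘′_)
open import Data.Product using (_×_; _,_; proj₁; proj₂)
open import Relation.Binary.PropositionalEquality
  using (_≡_; refl; sym; trans; cong; cong₂; _≗_; module ≡-Reasoning)

-- Equalities of functions are stated pointwise (functions in Set are
-- extensional); accordingly the action on functions is required to respect
-- pointwise equality (map-cong), which every functor on Set does.

record Applicative : Set₁ where
  infixl 5 _⊛_
  field
    F     : Set → Set
    map   : ∀ {A B : Set} → (A → B) → F A → F B
    pure  : ∀ {A : Set} → A → F A
    _⊛_   : ∀ {A B : Set} → F (A → B) → F A → F B
    map-cong     : ∀ {A B : Set} {f g : A → B} → f ≗ g → (x : F A) → map f x ≡ map g x
    identity     : ∀ {A : Set} (a : F A) → pure id ⊛ a ≡ a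
    homomorphism : ∀ {A B : Set} (f : A → B) (a : A) → pure f ⊛ pure a ≡ pure (f a)
    composition  : ∀ {A B C : Set} (g : F (B → C)) (f : F (A → B)) (a : F A) →
                   g ⊛ (f ⊛ a) ≡ pure _∘′_ ⊛ g ⊛ f ⊛ a
    interchange  : ∀ {A B : Set} (f : F (A → B)) (a : A) →
                   f ⊛ pure a ≡ pure (λ h → h a) ⊛ f
    map-pure     : ∀ {A B : Set} (f : A → B) (x : F A) → map f x ≡ pure f ⊛ x

record AppMorphism (F G : Applicative) : Set₁ where
  private
    module F = Applicative F
    module G = Applicative G
  field
    φ      : ∀ {A : Set} → F.F A → G.F A
    φ-nat  : ∀ {A B : Set} (f : A → B) (x : F.F A) → φ (F.map f x) ≡ G.map f (φ x)
    φ-pure : ∀ {A : Set} (a : A) → φ (F.pure a) ≡ G.pure a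
    φ-⊛    : ∀ {A B : Set} (h : F.F (A → B)) (x : F.F A) → φ (h F.⊛ x) ≡ φ h G.⊛ φ x

IdApp : Applicative
IdApp = record
  { F = λ A → A ; map = λ f → f ; pure = λ a → a ; _⊛_ = λ f a → f a
  ; map-cong = λ eq x → eq x
  ; identity = λ _ → refl ; homomorphism = λ _ _ → refl
  ; composition = λ _ _ _ → refl ; interchange = λ _ _ → refl
  ; map-pure = λ _ _ → refl }

module AppLemmas (Ap : Applicative) where
  open Applicative Ap
  open ≡-Reasoning

  fuse : ∀ {A B C : Set} (u : B → C) (v : A → B) (x : F A) →
         pure u ⊛ (pure v ⊛ x) ≡ pure (u ∘′ v) ⊛ x
  fuse u v x = begin
    pure u ⊛ (pure v ⊛ x)               ≡⟨ composition (pure u) (pure v) x ⟩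
    pure _∘′_ ⊛ pure u ⊛ pure v ⊛ x     ≡⟨ cong (λ z → z ⊛ pure v ⊛ x) (homomorphism _∘′_ u) ⟩
    pure (u ∘′_) ⊛ pure v ⊛ x           ≡⟨ cong (_⊛ x) (homomorphism (u ∘′_) v) ⟩
    pure (u ∘′ v) ⊛ x                   ∎

  pure-cong : ∀ {A B : Set} {f g : A → B} → f ≗ g → (x : F A) → pure f ⊛ x ≡ pure g ⊛ x
  pure-cong {f = f} {g} eq x =
    trans (sym (map-pure f x)) (trans (map-cong eq x) (map-pure g x))

  pushL : ∀ {A B C : Set} (h : B → C) (u : F (A → B)) (v : F A) →
          pure h ⊛ (u ⊛ v) ≡ pure (h ∘′_) ⊛ u ⊛ v
  pushL h u v = trans (composition (pure h) u v)
                      (cong (λ z → z ⊛ u ⊛ v) (homomorphism _∘′_ h))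

  pushR : ∀ {A B C : Set} (u : F (B → C)) (h : A → B) (v : F A) →
          u ⊛ (pure h ⊛ v) ≡ pure (λ k → k ∘′ h) ⊛ u ⊛ v
  pushR u h v = begin
    u ⊛ (pure h ⊛ v)                       ≡⟨ composition u (pure h) v ⟩
    pure _∘′_ ⊛ u ⊛ pure h ⊛ v             ≡⟨ cong (_⊛ v) (interchange (pure _∘′_ ⊛ u) h) ⟩
    pure (λ k → k h) ⊛ (pure _∘′_ ⊛ u) ⊛ v ≡⟨ cong (_⊛ v) (fuse (λ k → k h) _∘′_ u) ⟩
    pure (λ k → k ∘′ h) ⊛ u ⊛ v            ∎

  tuple3 : ∀ {X Y Z R : Set} (K : X → Y → Z → R) (g : F X) (f : F Y) (a : F Z) →
           pure K ⊛ g ⊛ f ⊛ a ≡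
           pure (λ p → K (proj₁ (proj₁ p)) (proj₂ (proj₁ p)) (proj₂ p))
             ⊛ (pure _,_ ⊛ (pure _,_ ⊛ g ⊛ f) ⊛ a)
  tuple3 K g f a = sym (begin
    pure K3 ⊛ (pure _,_ ⊛ q ⊛ a)           ≡⟨ pushL K3 (pure _,_ ⊛ q) a ⟩
    pure (K3 ∘′_) ⊛ (pure _,_ ⊛ q) ⊛ a     ≡⟨ cong (_⊛ a) (fuse (K3 ∘′_) _,_ q) ⟩
    pure K2 ⊛ (pure _,_ ⊛ g ⊛ f) ⊛ a       ≡⟨ cong (_⊛ a) (pushL K2 (pure _,_ ⊛ g) f) ⟩
    pure (K2 ∘′_) ⊛ (pure _,_ ⊛ g) ⊛ f ⊛ a ≡⟨ cong (λ z → z ⊛ f ⊛ a) (fuse (K2 ∘′_) _,_ g) ⟩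
    pure K ⊛ g ⊛ f ⊛ a                     ∎)
    where
    K3 = λ p → K (proj₁ (proj₁ p)) (proj₂ (proj₁ p)) (proj₂ p)
    q  = pure _,_ ⊛ g ⊛ f
    K2 = (K3 ∘′_) ∘′ _,_

_∘A_ : Applicative → Applicative → Applicative
FA ∘A GA = record
  { F = λ A → F.F (G.F A)
  ; map = λ f → F.map (G.map f)
  ; pure = λ a → F.pure (G.pure a)
  ; _⊛_ = _⊛C_
  ; map-cong = λ eq → F.map-cong (G.map-cong eq)
  ; identity = identityC
  ; homomorphism = homC
  ; composition = compC
  ; interchange = interC
  ; map-pure = mapPureC
  }
  where
  module F = Applicative FA
  module G = Applicative GA
  module LF = AppLemmas FA
  open ≡-Reasoning
  open F using (_⊛_)

  infixl 5 _⊛C_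
  _⊛C_ : ∀ {A B : Set} → F.F (G.F (A → B)) → F.F (G.F A) → F.F (G.F B)
  h ⊛C x = F.pure G._⊛_ ⊛ h ⊛ x

  identityC : ∀ {A : Set} (a : F.F (G.F A)) → F.pure (G.pure id) ⊛C a ≡ a
  identityC a = begin
    F.pure G._⊛_ ⊛ F.pure (G.pure id) ⊛ a ≡⟨ cong (_⊛ a) (F.homomorphism G._⊛_ (G.pure id)) ⟩
    F.pure (G.pure id G.⊛_) ⊛ a           ≡⟨ LF.pure-cong G.identity a ⟩
    F.pure id ⊛ a                         ≡⟨ F.identity a ⟩
    a                                     ∎

  homC : ∀ {A B : Set} (f : A → B) (a : A) →
         F.pure (G.pure f) ⊛C F.pure (G.pure a) ≡ F.pure (G.pure (f a))
  homC f a = begin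
    F.pure G._⊛_ ⊛ F.pure (G.pure f) ⊛ F.pure (G.pure a)
      ≡⟨ cong (_⊛ F.pure (G.pure a)) (F.homomorphism G._⊛_ (G.pure f)) ⟩
    F.pure (G.pure f G.⊛_) ⊛ F.pure (G.pure a)
      ≡⟨ F.homomorphism (G.pure f G.⊛_) (G.pure a) ⟩
    F.pure (G.pure f G.⊛ G.pure a)
      ≡⟨ cong F.pure (G.homomorphism f a) ⟩
    F.pure (G.pure (f a)) ∎

  interC : ∀ {A B : Set} (f : F.F (G.F (A → B))) (a : A) →
           f ⊛C F.pure (G.pure a) ≡ F.pure (G.pure (λ h → h a)) ⊛C f
  interC f a = begin
    F.pure G._⊛_ ⊛ f ⊛ F.pure (G.pure a)
      ≡⟨ F.interchange (F.pure G._⊛_ ⊛ f) (G.pure a) ⟩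
    F.pure (λ k → k (G.pure a)) ⊛ (F.pure G._⊛_ ⊛ f)
      ≡⟨ LF.fuse (λ k → k (G.pure a)) G._⊛_ f ⟩
    F.pure (λ x → x G.⊛ G.pure a) ⊛ f
      ≡⟨ LF.pure-cong (λ x → G.interchange x a) f ⟩
    F.pure (G.pure (λ h → h a) G.⊛_) ⊛ f
      ≡⟨ cong (_⊛ f) (sym (F.homomorphism G._⊛_ (G.pure (λ h → h a)))) ⟩
    F.pure G._⊛_ ⊛ F.pure (G.pure (λ h → h a)) ⊛ f ∎

  mapPureC : ∀ {A B : Set} (f : A → B) (x : F.F (G.F A)) →
             F.map (G.map f) x ≡ F.pure (G.pure f) ⊛C x
  mapPureC f x = begin
    F.map (G.map f) x                   ≡⟨ F.map-pure (G.map f) x ⟩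
    F.pure (G.map f) ⊛ x                ≡⟨ LF.pure-cong (G.map-pure f) x ⟩
    F.pure (G.pure f G.⊛_) ⊛ x          ≡⟨ cong (_⊛ x) (sym (F.homomorphism G._⊛_ (G.pure f))) ⟩
    F.pure G._⊛_ ⊛ F.pure (G.pure f) ⊛ x ∎

  compC : ∀ {A B C : Set} (g : F.F (G.F (B → C))) (f : F.F (G.F (A → B))) (a : F.F (G.F A)) →
          g ⊛C (f ⊛C a) ≡ F.pure (G.pure _∘′_) ⊛C g ⊛C f ⊛C a
  compC {A} {B} {C} g f a = begin
    P ⊛ g ⊛ (P ⊛ f ⊛ a)
      ≡⟨ F.composition (P ⊛ g) (P ⊛ f) a ⟩
    F.pure _∘′_ ⊛ (P ⊛ g) ⊛ (P ⊛ f) ⊛ a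
      ≡⟨ cong (λ z → z ⊛ (P ⊛ f) ⊛ a) (LF.fuse _∘′_ G._⊛_ g) ⟩
    F.pure k1 ⊛ g ⊛ (P ⊛ f) ⊛ a
      ≡⟨ cong (_⊛ a) (LF.pushR (F.pure k1 ⊛ g) G._⊛_ f) ⟩
    F.pure (λ k → k ∘′ G._⊛_) ⊛ (F.pure k1 ⊛ g) ⊛ f ⊛ a
      ≡⟨ cong (λ z → z ⊛ f ⊛ a) (LF.fuse (λ k → k ∘′ G._⊛_) k1 g) ⟩
    F.pure K1 ⊛ g ⊛ f ⊛ a
      ≡⟨ LF.tuple3 K1 g f a ⟩
    F.pure (λ p → K1 (proj₁ (proj₁ p)) (proj₂ (proj₁ p)) (proj₂ p)) ⊛ t
      ≡⟨ LF.pure-cong (λ p → G.composition (proj₁ (proj₁ p)) (proj₂ (proj₁ p)) (proj₂ p)) t ⟩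
    F.pure (λ p → K2 (proj₁ (proj₁ p)) (proj₂ (proj₁ p)) (proj₂ p)) ⊛ t
      ≡⟨ sym (LF.tuple3 K2 g f a) ⟩
    F.pure K2 ⊛ g ⊛ f ⊛ a
      ≡⟨ cong (λ z → z ⊛ f ⊛ a) (sym (LF.fuse (G._⊛_ ∘′_) k2 g)) ⟩
    F.pure (G._⊛_ ∘′_) ⊛ (F.pure k2 ⊛ g) ⊛ f ⊛ a
      ≡⟨ cong (_⊛ a) (sym (LF.pushL G._⊛_ (F.pure k2 ⊛ g) f)) ⟩
    P ⊛ (F.pure k2 ⊛ g ⊛ f) ⊛ a
      ≡⟨ cong (λ z → P ⊛ (z ⊛ f) ⊛ a) (sym (LF.fuse G._⊛_ (G.pure _∘′_ G.⊛_) g)) ⟩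
    P ⊛ (P ⊛ (F.pure (G.pure _∘′_ G.⊛_) ⊛ g) ⊛ f) ⊛ a
      ≡⟨ cong (λ z → P ⊛ (P ⊛ (z ⊛ g) ⊛ f) ⊛ a) (sym (F.homomorphism G._⊛_ (G.pure _∘′_))) ⟩
    P ⊛ (P ⊛ (P ⊛ F.pure (G.pure _∘′_) ⊛ g) ⊛ f) ⊛ a ∎
    where
    P : ∀ {X Y : Set} → F.F (G.F (X → Y) → G.F X → G.F Y)
    P = F.pure G._⊛_
    k1 = _∘′_ ∘′ G._⊛_ {A = B} {B = C}
    K1 = λ (x : G.F (B → C)) (y : G.F (A → B)) (z : G.F A) → x G.⊛ (y G.⊛ z)
    K2 = λ (x : G.F (B → C)) (y : G.F (A → B)) (z : G.F A) → G.pure _∘′_ G.⊛ x G.⊛ y G.⊛ z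
    k2 = λ (x : G.F (B → C)) → G.pure (_∘′_ {A = A}) G.⊛ x G.⊛_
    t = F.pure _,_ ⊛ (F.pure _,_ ⊛ g ⊛ f) ⊛ a

module Writer {W : Set} (_·_ : W → W → W) (e : W) where
  extr : ∀ {A : Set} → W × A → A
  extr (w , a) = a

  dup : ∀ {A : Set} → W × A → W × (W × A)
  dup (w , a) = (w , (w , a))

  retW : ∀ {A : Set} → A → W × A
  retW a = (e , a)

  joinW : ∀ {A : Set} → W × (W × A) → W × A
  joinW (w₁ , (w₂ , a)) = (w₁ · w₂ , a)

  mapW : ∀ {A B : Set} → (A → B) → W × A → W × B
  mapW f (w , a) = (w , f a)

  σ : {G : Set → Set} (mapG : ∀ {A B : Set} → (A → B) → G A → G B) →
      ∀ {A : Set} → W × G A → G (W × A)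
  σ mapG (w , x) = mapG (λ a → (w , a)) x

  _⊙_ : ∀ {B R : Set} → (W × B → R) → W → W × B → R
  (g ⊙ w₁) (w₂ , b) = g (w₁ · w₂ , b)

record DTM (W : Set) (_·_ : W → W → W) (e : W) : Set₂ where
  open Writer _·_ e
  open Applicative using (F)
  field
    T      : Set → Set
    map    : ∀ {A B : Set} → (A → B) → T A → T B
    map-id   : ∀ {A : Set} (x : T A) → map id x ≡ x
    map-∘    : ∀ {A B C : Set} (g : B → C) (f : A → B) (x : T A) →
               map (g ∘′ f) x ≡ map g (map f x)
    map-cong : ∀ {A B : Set} {f g : A → B} → f ≗ g → (x : T A) → map f x ≡ map g x

    ret    : ∀ {A : Set} → A → T A
    join   : ∀ {A : Set} → T (T A) → T A
    dec    : ∀ {A : Set} → T A → T (W × A)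
    dist   : (Ap : Applicative) → ∀ {A : Set} → T (F Ap A) → F Ap (T A)

    ret-nat  : ∀ {A B : Set} (f : A → B) (a : A) → map f (ret a) ≡ ret (f a)
    join-nat : ∀ {A B : Set} (f : A → B) (x : T (T A)) → map f (join x) ≡ join (map (map f) x)
    dec-nat  : ∀ {A B : Set} (f : A → B) (x : T A) → map (mapW f) (dec x) ≡ dec (map f x)
    dist-nat : (Ap : Applicative) → ∀ {A B : Set} (f : A → B) (x : T (F Ap A)) →
               dist Ap (map (Applicative.map Ap f) x) ≡ Applicative.map Ap (map f) (dist Ap x)

    join-ret     : ∀ {A : Set} (x : T A) → join (ret x) ≡ x
    join-map-ret : ∀ {A : Set} (x : T A) → join (map ret x) ≡ x
    join-join    : ∀ {A : Set} (x : T (T (T A))) → join (join x) ≡ join (map join x)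

    dec-extr : ∀ {A : Set} (x : T A) → map extr (dec x) ≡ x
    dec-dup  : ∀ {A : Set} (x : T A) → map dup (dec x) ≡ dec (dec x)
    dec-ret  : ∀ {A : Set} (a : A) → dec (ret a) ≡ ret (retW a)
    dec-join : ∀ {A : Set} (x : T (T A)) →
               dec (join x) ≡ join (map (map joinW ∘′ σ map) (dec (map dec x)))

    dist-id    : ∀ {A : Set} (x : T A) → dist IdApp x ≡ x
    dist-comp  : (Ap Bp : Applicative) → ∀ {A : Set} (x : T (F Ap (F Bp A))) →
                 dist (Ap ∘A Bp) x ≡ Applicative.map Ap (dist Bp) (dist Ap x)
    dist-morph : (Ap Bp : Applicative) (ψ : AppMorphism Ap Bp) → ∀ {A : Set} (x : T (F Ap A)) →
                 AppMorphism.φ ψ (dist Ap x) ≡ dist Bp (map (AppMorphism.φ ψ) x)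
    dist-ret   : (Ap : Applicative) → ∀ {A : Set} (x : F Ap A) →
                 dist Ap (ret x) ≡ Applicative.map Ap ret x
    dist-join  : (Ap : Applicative) → ∀ {A : Set} (x : T (T (F Ap A))) →
                 dist Ap (join x) ≡ Applicative.map Ap join (dist Ap (map (dist Ap) x))
    dist-dec   : (Ap : Applicative) → ∀ {A : Set} (x : T (F Ap A)) →
                 Applicative.map Ap dec (dist Ap x) ≡
                 dist Ap (map (σ (Applicative.map Ap)) (dec x))

  binddt : (Ap : Applicative) → ∀ {A B : Set} → (W × A → F Ap (T B)) → T A → F Ap (T B)
  binddt Ap f = Applicative.map Ap join ∘′ dist Ap ∘′ map f ∘′ dec

-- The traversal laws of dist turn every binddt-expression into "map join ∘ dist ∘ map k ∘ dec"
-- for a suitable k.  K1, K2 and K4 are then immediate from the unit, naturality and morphism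
-- laws.  For K3 the point is that binddt g commutes with join (using dec-join and dist-join)
-- and that both sides reduce to the same map over dist_F (map f (dec t)) (using dec-dup,
-- dist-dec and dist-comp).
module Submission where

open import Defs
open import Function using (id; _∘′_)
open import Data.Product using (_×_; _,_; proj₁; proj₂)
open import Relation.Binary.PropositionalEquality
  using (_≡_; sym; trans; cong; module ≡-Reasoning)
open import Algebra.Structures using (IsMonoid)

module ApplicativeProperties (Ap : Applicative) where
  open Applicative Ap
  open AppLemmas Ap using (fuse)

  map-∘ : ∀ {A B C : Set} (g : B → C) (f : A → B) (x : F A) →
          map (g ∘′ f) x ≡ map g (map f x)
  map-∘ g f x = sym (trans (map-pure g _) (trans (cong (pure g ⊛_) (map-pure f x))
                  (trans (fuse g f x) (sym (map-pure (g ∘′ f) x)))))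

  map-id : ∀ {A : Set} (x : F A) → map id x ≡ x
  map-id x = trans (map-pure id x) (identity x)

module DTMProperties {W : Set} {_·_ : W → W → W} {e : W} (D : DTM W _·_ e) where
  open DTM D
  open Writer _·_ e
  open ≡-Reasoning

  map-dec-map : ∀ {A B X : Set} (k : W × B → X) (f : A → B) (x : T A) →
                map k (dec (map f x)) ≡ map (k ∘′ mapW f) (dec x)
  map-dec-map k f x = trans (cong (map k) (sym (dec-nat f x))) (sym (map-∘ k (mapW f) _))

  map-dec-dec : ∀ {A B X : Set} (k : W × B → X) (f : W × A → B) (t : T A) →
                map k (dec (map f (dec t))) ≡ map (λ p → k (proj₁ p , f p)) (dec t)
  map-dec-dec k f t = begin
    map k (dec (map f (dec t)))               ≡⟨ map-dec-map k f (dec t) ⟩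
    map (k ∘′ mapW f) (dec (dec t))           ≡⟨ cong (map _) (sym (dec-dup t)) ⟩
    map (k ∘′ mapW f) (map dup (dec t))       ≡⟨ sym (map-∘ _ dup (dec t)) ⟩
    map (λ p → k (proj₁ p , f p)) (dec t)     ∎

  map-dec-join : ∀ {A X : Set} (g : W × A → X) (y : T (T A)) →
                 map g (dec (join y)) ≡ join (map (λ p → map (g ⊙ proj₁ p) (dec (proj₂ p))) (dec y))
  map-dec-join g y = begin
    map g (dec (join y))                        ≡⟨ cong (map g) (dec-join y) ⟩
    map g (join (map shift (dec (map dec y)))) ≡⟨ join-nat g _ ⟩
    join (map (map g) (map shift (dec (map dec y))))
      ≡⟨ cong join (sym (map-∘ (map g) shift _)) ⟩
    join (map (map g ∘′ shift) (dec (map dec y)))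
      ≡⟨ cong join (map-dec-map (map g ∘′ shift) dec y) ⟩
    join (map (λ p → map g (map joinW (map (proj₁ p ,_) (dec (proj₂ p))))) (dec y))
      ≡⟨ cong join (map-cong (λ p → trans (cong (map g) (sym (map-∘ joinW _ _))) (sym (map-∘ g _ _))) (dec y)) ⟩
    join (map (λ p → map (g ⊙ proj₁ p) (dec (proj₂ p))) (dec y)) ∎
    where
    shift : ∀ {B : Set} → W × T (W × B) → T (W × B)
    shift = map joinW ∘′ σ map

  module _ (Ap : Applicative) where
    open Applicative Ap using (F) renaming (map to mapF)
    open ApplicativeProperties Ap using () renaming (map-∘ to mapF-∘)

    map-join-dist-join : ∀ {A : Set} (x : T (T (F (T A)))) →
                         mapF join (dist Ap (join x)) ≡ mapF join (dist Ap (map (mapF join ∘′ dist Ap) x))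
    map-join-dist-join x = begin
      mapF join (dist Ap (join x))                              ≡⟨ cong (mapF join) (dist-join Ap x) ⟩
      mapF join (mapF join (dist Ap (map (dist Ap) x)))         ≡⟨ sym (mapF-∘ join join _) ⟩
      mapF (join ∘′ join) (dist Ap (map (dist Ap) x))           ≡⟨ Applicative.map-cong Ap join-join _ ⟩
      mapF (join ∘′ map join) (dist Ap (map (dist Ap) x))       ≡⟨ mapF-∘ join (map join) _ ⟩
      mapF join (mapF (map join) (dist Ap (map (dist Ap) x)))   ≡⟨ cong (mapF join) (sym (dist-nat Ap join _)) ⟩
      mapF join (dist Ap (map (mapF join) (map (dist Ap) x)))   ≡⟨ cong (mapF join ∘′ dist Ap) (sym (map-∘ _ _ x)) ⟩
      mapF join (dist Ap (map (mapF join ∘′ dist Ap) x))        ∎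

    dist-map-σ-dec : ∀ {A B : Set} (k : W × A → B) (x : T (F A)) →
                     dist Ap (map (mapF k ∘′ σ mapF) (dec x)) ≡ mapF (map k ∘′ dec) (dist Ap x)
    dist-map-σ-dec k x = begin
      dist Ap (map (mapF k ∘′ σ mapF) (dec x))       ≡⟨ cong (dist Ap) (map-∘ _ _ _) ⟩
      dist Ap (map (mapF k) (map (σ mapF) (dec x)))  ≡⟨ dist-nat Ap k _ ⟩
      mapF (map k) (dist Ap (map (σ mapF) (dec x)))  ≡⟨ cong (mapF (map k)) (sym (dist-dec Ap x)) ⟩
      mapF (map k) (mapF dec (dist Ap x))            ≡⟨ sym (mapF-∘ _ _ _) ⟩
      mapF (map k ∘′ dec) (dist Ap x)                ∎

    binddt-ret : ∀ {A B : Set} (f : W × A → F (T B)) (a : A) →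
                           binddt Ap f (ret a) ≡ f (retW a)
    binddt-ret f a = begin
      mapF join (dist Ap (map f (dec (ret a))))    ≡⟨ cong (mapF join ∘′ dist Ap ∘′ map f) (dec-ret a) ⟩
      mapF join (dist Ap (map f (ret (retW a))))   ≡⟨ cong (mapF join ∘′ dist Ap) (ret-nat f _) ⟩
      mapF join (dist Ap (ret (f (retW a))))       ≡⟨ cong (mapF join) (dist-ret Ap _) ⟩
      mapF join (mapF ret (f (retW a)))            ≡⟨ sym (mapF-∘ join ret _) ⟩
      mapF (join ∘′ ret) (f (retW a))              ≡⟨ Applicative.map-cong Ap join-ret _ ⟩
      mapF id (f (retW a))                         ≡⟨ ApplicativeProperties.map-id Ap _ ⟩
      f (retW a)                                   ∎

    binddt-join : ∀ {A B : Set} (g : W × A → F (T B)) (y : T (T A)) →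
                  binddt Ap g (join y) ≡ mapF join (dist Ap (map (λ p → binddt Ap (g ⊙ proj₁ p) (proj₂ p)) (dec y)))
    binddt-join {A} {B} g y = begin
      mapF join (dist Ap (map g (dec (join y))))        ≡⟨ cong (mapF join ∘′ dist Ap) (map-dec-join g y) ⟩
      mapF join (dist Ap (join (map decorated (dec y)))) ≡⟨ map-join-dist-join _ ⟩
      mapF join (dist Ap (map (mapF join ∘′ dist Ap) (map decorated (dec y))))
        ≡⟨ cong (mapF join ∘′ dist Ap) (sym (map-∘ _ decorated (dec y))) ⟩
      mapF join (dist Ap (map (λ p → binddt Ap (g ⊙ proj₁ p) (proj₂ p)) (dec y))) ∎
      where
      decorated : W × T A → T (F (T B))
      decorated p = map (g ⊙ proj₁ p) (dec (proj₂ p))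

  binddt-ret-extr : ∀ {A : Set} (t : T A) → binddt IdApp (ret ∘′ extr) t ≡ t
  binddt-ret-extr t = begin
    join (dist IdApp (map (ret ∘′ extr) (dec t)))   ≡⟨ cong join (dist-id _) ⟩
    join (map (ret ∘′ extr) (dec t))                ≡⟨ cong join (map-∘ ret extr (dec t)) ⟩
    join (map ret (map extr (dec t)))               ≡⟨ cong (join ∘′ map ret) (dec-extr t) ⟩
    join (map ret t)                                ≡⟨ join-map-ret t ⟩
    t                                               ∎

  binddt-morphism : (Ap Bp : Applicative) (ψ : AppMorphism Ap Bp) → ∀ {A B : Set}
                    (f : W × A → Applicative.F Ap (T B)) (t : T A) →
                    AppMorphism.φ ψ (binddt Ap f t) ≡ binddt Bp (AppMorphism.φ ψ ∘′ f) t
  binddt-morphism Ap Bp ψ f t = begin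
    φ (F.map join (dist Ap (map f (dec t))))       ≡⟨ φ-nat join _ ⟩
    G.map join (φ (dist Ap (map f (dec t))))       ≡⟨ cong (G.map join) (dist-morph Ap Bp ψ _) ⟩
    G.map join (dist Bp (map φ (map f (dec t))))   ≡⟨ cong (G.map join ∘′ dist Bp) (sym (map-∘ φ f _)) ⟩
    G.map join (dist Bp (map (φ ∘′ f) (dec t)))    ∎
    where
    module F = Applicative Ap
    module G = Applicative Bp
    open AppMorphism ψ

  binddt-binddt : (Ap Bp : Applicative) → ∀ {A B C : Set}
                  (g : W × B → Applicative.F Bp (T C)) (f : W × A → Applicative.F Ap (T B)) (t : T A) →
                  Applicative.map Ap (binddt Bp g) (binddt Ap f t)
                    ≡ binddt (Ap ∘A Bp) (λ p → Applicative.map Ap (binddt Bp (g ⊙ proj₁ p)) (f p)) t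
  binddt-binddt Ap Bp {A} {B} {C} g f t = begin
    F.map (binddt Bp g) (F.map join (dist Ap z))                 ≡⟨ sym (F′.map-∘ _ _ _) ⟩
    F.map (binddt Bp g ∘′ join) (dist Ap z)                      ≡⟨ F.map-cong (binddt-join Bp g) _ ⟩
    F.map (G.map join ∘′ dist Bp ∘′ map K ∘′ dec) (dist Ap z)    ≡⟨ F′.map-∘ _ _ _ ⟩
    F.map (G.map join ∘′ dist Bp) (F.map (map K ∘′ dec) (dist Ap z))
      ≡⟨ cong (F.map _) (sym (dist-map-σ-dec Ap K z)) ⟩
    F.map (G.map join ∘′ dist Bp) (dist Ap (map (F.map K ∘′ σ F.map) (dec z)))
      ≡⟨ cong (F.map _ ∘′ dist Ap) (map-dec-dec (F.map K ∘′ σ F.map) f t) ⟩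
    F.map (G.map join ∘′ dist Bp) (dist Ap (map (λ p → F.map K (F.map (proj₁ p ,_) (f p))) (dec t)))
      ≡⟨ cong (F.map _ ∘′ dist Ap) (map-cong (λ p → sym (F′.map-∘ K (proj₁ p ,_) (f p))) (dec t)) ⟩
    F.map (G.map join ∘′ dist Bp) (dist Ap (map h (dec t)))
      ≡⟨ F′.map-∘ _ _ _ ⟩
    F.map (G.map join) (F.map (dist Bp) (dist Ap (map h (dec t))))
      ≡⟨ cong (F.map (G.map join)) (sym (dist-comp Ap Bp _)) ⟩
    F.map (G.map join) (dist (Ap ∘A Bp) (map h (dec t)))         ∎
    where
    module F = Applicative Ap
    module F′ = ApplicativeProperties Ap
    module G = Applicative Bp
    z = map f (dec t)
    K : W × T B → G.F (T C)
    K p = binddt Bp (g ⊙ proj₁ p) (proj₂ p)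
    h : W × A → F.F (G.F (T C))
    h p = F.map (binddt Bp (g ⊙ proj₁ p)) (f p)

lemma26 : (W : Set) (_·_ : W → W → W) (e : W) → IsMonoid _≡_ _·_ e →
  (D : DTM W _·_ e) →
  let open DTM D
      open Writer _·_ e
  in
  -- (K1)
  (∀ {A : Set} (t : T A) → binddt IdApp (ret ∘′ extr) t ≡ t)
  -- (K2)
  × ((Ap : Applicative) → ∀ {A B : Set} (f : W × A → Applicative.F Ap (T B)) (a : A) →
      binddt Ap f (ret a) ≡ f (retW a))
  -- (K3)
  × ((Ap Bp : Applicative) → ∀ {A B C : Set}
      (g : W × B → Applicative.F Bp (T C)) (f : W × A → Applicative.F Ap (T B)) (t : T A) →
      Applicative.map Ap (binddt Bp g) (binddt Ap f t)
        ≡ binddt (Ap ∘A Bp)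
            (λ p → Applicative.map Ap (binddt Bp (g ⊙ proj₁ p)) (f p)) t)
  -- (K4)
  × ((Ap Bp : Applicative) (ψ : AppMorphism Ap Bp) → ∀ {A B : Set}
      (f : W × A → Applicative.F Ap (T B)) (t : T A) →
      AppMorphism.φ ψ (binddt Ap f t) ≡ binddt Bp (AppMorphism.φ ψ ∘′ f) t)
lemma26 W _·_ e _ D =
  binddt-ret-extr , binddt-ret , binddt-binddt , binddt-morphism
  where open DTMProperties D
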